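{- Let $\mathcal{A}=(1,1,1,\ldots)$ be the constant sequence of ones and $k$ a positive integer. Then the sequence $\left(p_\mathcal{A}(n,k)\right)_{n=0}^\infty$ is: (1) not asymptotically $1$-log-concave if and only if $k=1$; (2) asymptotically $1$-log-concave but not asymptotically $2$-log-concave if and only if $k=2$; (3) asymptotically $r$-log-concave for every $r\geqslant1$ if and only if $k\geqslant3$.
   Context: For a weakly increasing sequence $\mathcal{A}=(a_i)_{i\ge1}$ of positive integers and a positive integer $k$, $p_\mathcal{A}(n,k)$ is defined by $\sum_{n\ge0}p_\mathcal{A}(n,k)x^n=\prod_{i=1}^k\frac{1}{1-x^{a_i}}$; for $\mathcal{A}=(1,1,1,\dots)$ this is the number of ways to write $n$ as a sum of parts equal to $1$ coming in $k$ distinct colors. For a real sequence $\omega=(w_i)_{i\ge0}$ put $(\widehat{\mathcal{L}}\omega)_i=w_{i+1}^2-w_iw_{i+2}$ and $\widehat{\mathcal{L}}^j\omega=\widehat{\mathcal{L}}(\widehat{\mathcal{L}}^{j-1}\omega)$. The sequence $\omega$ is asymptotically $r$-log-concave if there is $N$ such that $(\widehat{\mathcal{L}}^j\omega)_i>0$ for all $j\in\{1,\dots,r\}$ and all $i\ge N$. -}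

module Defs where

open import Data.Nat using (ℕ; zero; suc; _*_; _∸_; _≤_; _≤ᵇ_)
open import Data.Bool using (if_then_else_)
open import Data.List using (map; upTo)
open import Data.Nat.ListAction using (sum)
open import Data.Integer as ℤ using (ℤ; +_)
open import Data.Product using (∃-syntax; _×_)

-- A weakly increasing sequence of positive integers is given as a function
-- a : ℕ → ℕ read from index 1 (a 0 is ignored), i.e. a i = a_i.

-- p a k n = coefficient of x^n in  ∏_{i=1}^{k} 1/(1 - x^{a_i}).
-- Multiplying by 1/(1 - x^{a_{k+1}}) = Σ_{j≥0} x^{j a_{k+1}} gives the
-- recursion below (for a_{k+1} ≥ 1, the terms with j ≤ n suffice).
p : (ℕ → ℕ) → ℕ → ℕ → ℕ
p a zero    zero    = 1
p a zero    (suc n) = 0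
p a (suc k) n =
  sum (map (λ j → if j * a (suc k) ≤ᵇ n then p a k (n ∸ j * a (suc k)) else 0)
           (upTo (suc n)))

ones : ℕ → ℕ
ones _ = 1

L : (ℕ → ℤ) → (ℕ → ℤ)
L ω i = ω (suc i) ℤ.* ω (suc i) ℤ.- ω i ℤ.* ω (suc (suc i))

L^ : ℕ → (ℕ → ℤ) → (ℕ → ℤ)
L^ zero    ω = ω
L^ (suc j) ω = L (L^ j ω)

AsympLogConcave : ℕ → (ℕ → ℤ) → Set
AsympLogConcave r ω =
  ∃[ N ] (∀ j → 1 ≤ j → j ≤ r → ∀ i → N ≤ i → + 0 ℤ.< L^ j ω i)

seqP : ℕ → (ℕ → ℤ)
seqP k n = + p ones k n

{-# OPTIONS --safe #-}
module Submission where

-- For A = (1,1,…), p(n,k) = C(n+k−1,k−1) is a polynomial in n of degree k−1 with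
-- positive leading coefficient, i.e. its (k−1)-st difference is constantly 1.
-- Writing L f = Δf·Δf(·+1) − f(·+1)·Δ²f and using the Leibniz rule for Δ, a
-- polynomial of degree d ≥ 1 with d-th difference K is sent by L to one of degree
-- 2d − 2 with (2d−2)-nd difference Cat(d−1)·K², Cat being the Catalan numbers.
-- So for k ≥ 3 every iterate of L is a polynomial of degree ≥ 2 with positive
-- leading coefficient, hence eventually positive; for k = 2, L(n+1) ≡ 1 and
-- L² ≡ 0; for k = 1, L(1) ≡ 0.

open import Defs
open import Data.Nat as ℕ using (ℕ; zero; suc; _≤_; z≤n; s≤s; _∸_; _⊔_; _≤ᵇ_; _<ᵇ_)
import Data.Nat.Properties as ℕₚ
open import Data.Nat.Combinatorics using (_C_; nCn≡1; nC1≡n; nCk+nC[k+1]≡[n+1]C[k+1])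
open import Data.Nat.ListAction using (sum)
import Data.Nat.Tactic.RingSolver as ℕ-Solver
open import Data.Integer as ℤ using (ℤ; +_; +[1+_]; -[1+_]; 0ℤ; _+_; _-_; -_; _*_; _<_; ∣_∣; +<+)
import Data.Integer.Properties as ℤₚ
open import Data.Integer.Tactic.RingSolver using (solve-∀)
open import Data.Bool using (if_then_else_)
open import Data.List using (map; upTo; applyUpTo)
open import Data.List.Properties using (map-upTo; map-cong)
open import Data.Product using (_×_; _,_; proj₂; ∃-syntax)
open import Data.Sum using (inj₁; inj₂)
open import Data.Empty using (⊥-elim)
open import Function using (_∘_)
open import Function.Bundles using (_⇔_; mk⇔)
open import Relation.Nullary using (¬_)
open import Relation.Binary.PropositionalEquality
open ≡-Reasoning

m<ᵇ1+n≡m≤ᵇn : ∀ m n → (m <ᵇ suc n) ≡ (m ≤ᵇ n)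
m<ᵇ1+n≡m≤ᵇn zero    n = refl
m<ᵇ1+n≡m≤ᵇn (suc m) n = refl

p-ones-suc : ∀ k n → p ones (suc k) (suc n) ≡ p ones k (suc n) ℕ.+ p ones (suc k) n
p-ones-suc k n = begin
  p ones (suc k) (suc n)
    ≡⟨⟩
  sum (map (term (suc n)) (upTo (suc (suc n))))
    ≡⟨ cong sum (map-upTo (term (suc n)) (suc (suc n))) ⟩
  p ones k (suc n) ℕ.+ sum (applyUpTo (term (suc n) ∘ suc) (suc n))
    ≡⟨ cong (λ s → p ones k (suc n) ℕ.+ sum s) (sym (map-upTo (term (suc n) ∘ suc) (suc n))) ⟩
  p ones k (suc n) ℕ.+ sum (map (term (suc n) ∘ suc) (upTo (suc n)))
    ≡⟨ cong (λ s → p ones k (suc n) ℕ.+ sum s) (map-cong term-suc (upTo (suc n))) ⟩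
  p ones k (suc n) ℕ.+ p ones (suc k) n ∎
  where
  term : ℕ → ℕ → ℕ
  term m j = if j ℕ.* 1 ≤ᵇ m then p ones k (m ∸ j ℕ.* 1) else 0

  term-suc : ∀ j → term (suc n) (suc j) ≡ term n j
  term-suc j = cong (λ b → if b then p ones k (n ∸ j ℕ.* 1) else 0) (m<ᵇ1+n≡m≤ᵇn (j ℕ.* 1) n)

p-ones-1 : ∀ n → p ones 1 n ≡ 1
p-ones-1 zero    = refl
p-ones-1 (suc n) = trans (p-ones-suc 0 n) (p-ones-1 n)

Δ : (ℕ → ℤ) → ℕ → ℤ
Δ f n = f (suc n) - f n

Δ^ : ℕ → (ℕ → ℤ) → ℕ → ℤ
Δ^ zero    f = f
Δ^ (suc d) f = Δ^ d (Δ f)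

Δ^-cong : ∀ d {f g} → f ≗ g → Δ^ d f ≗ Δ^ d g
Δ^-cong zero    f≗g = f≗g
Δ^-cong (suc d) f≗g = Δ^-cong d (λ n → cong₂ _-_ (f≗g (suc n)) (f≗g n))

Δ^-∘suc : ∀ d f → Δ^ d (f ∘ suc) ≗ Δ^ d f ∘ suc
Δ^-∘suc zero    f n = refl
Δ^-∘suc (suc d) f n = Δ^-∘suc d (Δ f) n

Δ^-distrib : (_⊕_ : ℤ → ℤ → ℤ) → (∀ w x y z → (w ⊕ x) - (y ⊕ z) ≡ (w - y) ⊕ (x - z)) →
             ∀ d f g → Δ^ d (λ n → f n ⊕ g n) ≗ (λ n → Δ^ d f n ⊕ Δ^ d g n)
Δ^-distrib _⊕_ Δ-⊕ zero    f g n = refl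
Δ^-distrib _⊕_ Δ-⊕ (suc d) f g n =
  trans (Δ^-cong d (λ m → Δ-⊕ (f (suc m)) (g (suc m)) (f m) (g m)) n)
        (Δ^-distrib _⊕_ Δ-⊕ d (Δ f) (Δ g) n)

Δ^-+ : ∀ d f g → Δ^ d (λ n → f n + g n) ≗ (λ n → Δ^ d f n + Δ^ d g n)
Δ^-+ = Δ^-distrib _+_ solve-∀

Δ^-- : ∀ d f g → Δ^ d (λ n → f n - g n) ≗ (λ n → Δ^ d f n - Δ^ d g n)
Δ^-- = Δ^-distrib _-_ solve-∀

Δ^-*ˡ : ∀ d c g → Δ^ d (λ n → c * g n) ≗ (λ n → c * Δ^ d g n)
Δ^-*ˡ d c g = Δ^-distrib (λ _ x → c * x) (λ _ x _ z → *-distribˡ-- c x z) d g g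
  where
  *-distribˡ-- : ∀ c x z → c * x - c * z ≡ c * (x - z)
  *-distribˡ-- = solve-∀

Δ-* : ∀ f g n → Δ (λ m → f m * g m) n ≡ Δ f n * g (suc n) + f n * Δ g n
Δ-* f g n = leibniz (f n) (f (suc n)) (g n) (g (suc n))
  where
  leibniz : ∀ a a′ b b′ → a′ * b′ - a * b ≡ (a′ - a) * b′ + a * (b′ - b)
  leibniz = solve-∀

-- Over ℕ → ℤ, a constant d-th difference means f is a polynomial of degree ≤ d
-- whose coefficient of n^d is K / d!.
Δ^Const : ℕ → ℤ → (ℕ → ℤ) → Set
Δ^Const d K f = ∀ n → Δ^ d f n ≡ K

Δ^Const-∘suc : ∀ d {K} f → Δ^Const d K f → Δ^Const d K (f ∘ suc)
Δ^Const-∘suc d f f-const n = trans (Δ^-∘suc d f n) (f-const (suc n))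

Δ^Const-- : ∀ d {K M} f g → Δ^Const d K f → Δ^Const d M g → Δ^Const d (K - M) (λ n → f n - g n)
Δ^Const-- d f g f-const g-const n =
  trans (Δ^-- d f g n) (cong₂ _-_ (f-const n) (g-const n))

Δ^Const-* : ∀ a b {K M} f g → Δ^Const a K f → Δ^Const b M g →
            Δ^Const (a ℕ.+ b) (+ ((a ℕ.+ b) C a) * K * M) (λ n → f n * g n)
Δ^Const-* zero b {K} {M} f g f-const g-const n = begin
  Δ^ b (λ m → f m * g m) n  ≡⟨ Δ^-cong b (λ m → cong (_* g m) (f-const m)) n ⟩
  Δ^ b (λ m → K * g m) n    ≡⟨ Δ^-*ˡ b K g n ⟩
  K * Δ^ b g n              ≡⟨ cong (K *_) (g-const n) ⟩
  K * M                     ≡⟨ cong (_* M) (sym (ℤₚ.*-identityˡ K)) ⟩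
  + 1 * K * M               ∎
Δ^Const-* (suc a) zero {K} {M} f g f-const g-const n
  rewrite ℕₚ.+-identityʳ a | nCn≡1 (suc a) = begin
  Δ^ (suc a) (λ m → f m * g m) n  ≡⟨ Δ^-cong (suc a) (λ m → trans (cong (f m *_) (g-const m))
                                                                    (ℤₚ.*-comm (f m) M)) n ⟩
  Δ^ (suc a) (λ m → M * f m) n    ≡⟨ Δ^-*ˡ (suc a) M f n ⟩
  M * Δ^ (suc a) f n              ≡⟨ cong (M *_) (f-const n) ⟩
  M * K                           ≡⟨ swap M K ⟩
  + 1 * K * M                     ∎
  where
  swap : ∀ M K → M * K ≡ + 1 * K * M
  swap = solve-∀
Δ^Const-* (suc a) (suc b) {K} {M} f g f-const g-const n = begin
  Δ^ d (Δ (λ m → f m * g m)) n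
    ≡⟨ Δ^-cong d (Δ-* f g) n ⟩
  Δ^ d (λ m → Δ f m * g (suc m) + f m * Δ g m) n
    ≡⟨ Δ^-+ d (λ m → Δ f m * g (suc m)) (λ m → f m * Δ g m) n ⟩
  Δ^ d (λ m → Δ f m * g (suc m)) n + Δ^ d (λ m → f m * Δ g m) n
    ≡⟨ cong₂ _+_ (Δ^Const-* a (suc b) (Δ f) (g ∘ suc) f-const (Δ^Const-∘suc (suc b) g g-const) n)
                 (Δf*g-const n) ⟩
  + (d C a) * K * M + + (d C suc a) * K * M
    ≡⟨ collect (d C a) (d C suc a) ⟩
  + (d C a ℕ.+ d C suc a) * K * M
    ≡⟨ cong (λ c → + c * K * M) (nCk+nC[k+1]≡[n+1]C[k+1] d a) ⟩
  + (suc d C suc a) * K * M ∎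
  where
  d = a ℕ.+ suc b

  Δf*g-const : Δ^Const d (+ (d C suc a) * K * M) (λ m → f m * Δ g m)
  Δf*g-const = subst (λ e → Δ^Const e (+ (e C suc a) * K * M) (λ m → f m * Δ g m))
                     (sym (ℕₚ.+-suc a b)) (Δ^Const-* (suc a) b f (Δ g) f-const g-const)

  collect : ∀ x y → + x * K * M + + y * K * M ≡ + (x ℕ.+ y) * K * M
  collect x y = trans (distrib (+ x) (+ y) K M) (cong (λ z → z * K * M) (sym (ℤₚ.pos-+ x y)))
    where
    distrib : ∀ x y K M → x * K * M + y * K * M ≡ (x + y) * K * M
    distrib = solve-∀

-- (k+1)·C(n,k+1) = (n−k)·C(n,k), with k·C(n,k) moved across to avoid truncated subtraction.
[1+k]*nC[1+k]+k*nCk≡n*nCk : ∀ n k → suc k ℕ.* (n C suc k) ℕ.+ k ℕ.* (n C k) ≡ n ℕ.* (n C k)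
[1+k]*nC[1+k]+k*nCk≡n*nCk zero    zero    = refl
[1+k]*nC[1+k]+k*nCk≡n*nCk zero    (suc k) =
  cong₂ ℕ._+_ (ℕₚ.*-zeroʳ (suc (suc k))) (ℕₚ.*-zeroʳ (suc k))
[1+k]*nC[1+k]+k*nCk≡n*nCk (suc n) zero    = begin
  1 ℕ.* (suc n C 1) ℕ.+ 0  ≡⟨ ℕₚ.+-identityʳ _ ⟩
  1 ℕ.* (suc n C 1)        ≡⟨ ℕₚ.*-identityˡ _ ⟩
  suc n C 1                ≡⟨ nC1≡n (suc n) ⟩
  suc n                    ≡⟨ ℕₚ.*-identityʳ (suc n) ⟨
  suc n ℕ.* 1              ∎
[1+k]*nC[1+k]+k*nCk≡n*nCk (suc n) (suc k) = begin
  suc (suc k) ℕ.* (suc n C suc (suc k)) ℕ.+ suc k ℕ.* (suc n C suc k)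
    ≡⟨ cong₂ (λ x y → suc (suc k) ℕ.* x ℕ.+ suc k ℕ.* y)
             (sym (nCk+nC[k+1]≡[n+1]C[k+1] n (suc k))) (sym (nCk+nC[k+1]≡[n+1]C[k+1] n k)) ⟩
  suc (suc k) ℕ.* (b ℕ.+ c) ℕ.+ suc k ℕ.* (a ℕ.+ b)
    ≡⟨ regroup k a b c ⟩
  (suc (suc k) ℕ.* c ℕ.+ suc k ℕ.* b) ℕ.+ (suc k ℕ.* b ℕ.+ k ℕ.* a) ℕ.+ (a ℕ.+ b)
    ≡⟨ cong₂ (λ u v → u ℕ.+ v ℕ.+ (a ℕ.+ b))
             ([1+k]*nC[1+k]+k*nCk≡n*nCk n (suc k)) ([1+k]*nC[1+k]+k*nCk≡n*nCk n k) ⟩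
  n ℕ.* b ℕ.+ n ℕ.* a ℕ.+ (a ℕ.+ b)
    ≡⟨ factor n a b ⟩
  suc n ℕ.* (a ℕ.+ b)
    ≡⟨ cong (suc n ℕ.*_) (nCk+nC[k+1]≡[n+1]C[k+1] n k) ⟩
  suc n ℕ.* (suc n C suc k) ∎
  where
  a = n C k
  b = n C suc k
  c = n C suc (suc k)

  regroup : ∀ k a b c → suc (suc k) ℕ.* (b ℕ.+ c) ℕ.+ suc k ℕ.* (a ℕ.+ b) ≡
            (suc (suc k) ℕ.* c ℕ.+ suc k ℕ.* b) ℕ.+ (suc k ℕ.* b ℕ.+ k ℕ.* a) ℕ.+ (a ℕ.+ b)
  regroup = ℕ-Solver.solve-∀

  factor : ∀ n a b → n ℕ.* b ℕ.+ n ℕ.* a ℕ.+ (a ℕ.+ b) ≡ suc n ℕ.* (a ℕ.+ b)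
  factor = ℕ-Solver.solve-∀

nCk>0 : ∀ {n k} → k ≤ n → 0 ℕ.< n C k
nCk>0 {n}     {zero}  _         = s≤s z≤n
nCk>0 {suc n} {suc k} (s≤s k≤n) =
  ℕₚ.<-≤-trans (nCk>0 k≤n)
    (ℕₚ.≤-trans (ℕₚ.m≤m+n (n C k) (n C suc k)) (ℕₚ.≤-reflexive (nCk+nC[k+1]≡[n+1]C[k+1] n k)))

[2m]C[1+m]<[2m]Cm : ∀ m → (m ℕ.+ m) C suc m ℕ.< (m ℕ.+ m) C m
[2m]C[1+m]<[2m]Cm m = ℕₚ.*-cancelˡ-< (suc m) _ _
  (subst (ℕ._< suc m ℕ.* (n C m)) (sym absorption)
         (ℕₚ.m<n+m (m ℕ.* (n C m)) (nCk>0 (ℕₚ.m≤n+m m m))))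
  where
  n = m ℕ.+ m

  absorption : suc m ℕ.* (n C suc m) ≡ m ℕ.* (n C m)
  absorption = ℕₚ.+-cancelʳ-≡ _ _ (m ℕ.* (n C m))
    (trans ([1+k]*nC[1+k]+k*nCk≡n*nCk n m) (ℕₚ.*-distribʳ-+ (n C m) m m))

catalan : ℕ → ℕ
catalan m = (m ℕ.+ m) C m ∸ (m ℕ.+ m) C suc m

catalan>0 : ∀ m → 0 ℕ.< catalan m
catalan>0 m = ℕₚ.m<n⇒0<n∸m ([2m]C[1+m]<[2m]Cm m)

+m-+n≡+[m∸n] : ∀ {m n} → n ≤ m → + m - + n ≡ + (m ∸ n)
+m-+n≡+[m∸n] {m} {n} n≤m = trans (ℤₚ.m-n≡m⊖n m n) (ℤₚ.⊖-≥ n≤m)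

-- Each summand is a product of polynomials of lower degree, so the Leibniz rule
-- yields the leading coefficient of L f.
L-via-Δ : ∀ f n → L f n ≡ Δ f n * Δ f (suc n) - f (suc n) * Δ (Δ f) n
L-via-Δ f n = identity (f n) (f (suc n)) (f (suc (suc n)))
  where
  identity : ∀ a b c → b * b - a * c ≡ (b - a) * (c - b) - b * ((c - b) - (b - a))
  identity = solve-∀

L-Δ^Const-0 : ∀ {K} f → Δ^Const 0 K f → ∀ n → L f n ≡ 0ℤ
L-Δ^Const-0 {K} f f-const n = begin
  f (suc n) * f (suc n) - f n * f (suc (suc n))
    ≡⟨ cong₂ _-_ (cong₂ _*_ (f-const (suc n)) (f-const (suc n)))
                 (cong₂ _*_ (f-const n) (f-const (suc (suc n)))) ⟩
  K * K - K * K
    ≡⟨ ℤₚ.+-inverseʳ (K * K) ⟩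
  0ℤ ∎

L-Δ^Const : ∀ m {K} f → Δ^Const (suc m) K f → Δ^Const (m ℕ.+ m) (+ catalan m * (K * K)) (L f)
L-Δ^Const zero {K} f f-const n = begin
  L f n
    ≡⟨ L-via-Δ f n ⟩
  Δ f n * Δ f (suc n) - f (suc n) * (Δ f (suc n) - Δ f n)
    ≡⟨ cong₂ (λ x y → x * y - f (suc n) * (y - x)) (f-const n) (f-const (suc n)) ⟩
  K * K - f (suc n) * (K - K)
    ≡⟨ vanish K (f (suc n)) ⟩
  + 1 * (K * K) ∎
  where
  vanish : ∀ K x → K * K - x * (K - K) ≡ + 1 * (K * K)
  vanish = solve-∀
L-Δ^Const (suc e) {K} f f-const n = begin
  Δ^ d (L f) n
    ≡⟨ Δ^-cong d (L-via-Δ f) n ⟩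
  Δ^ d (λ m → Δ f m * Δ f (suc m) - f (suc m) * Δ (Δ f) m) n
    ≡⟨ Δ^Const-- d (λ m → Δ f m * Δ f (suc m)) (λ m → f (suc m) * Δ (Δ f) m)
                  Δf*Δf∘suc-const f∘suc*Δ²f-const n ⟩
  + (d C suc e) * K * K - + (d C suc (suc e)) * K * K
    ≡⟨ factor (+ (d C suc e)) (+ (d C suc (suc e))) K ⟩
  (+ (d C suc e) - + (d C suc (suc e))) * (K * K)
    ≡⟨ cong (_* (K * K)) (+m-+n≡+[m∸n] (ℕₚ.<⇒≤ ([2m]C[1+m]<[2m]Cm (suc e)))) ⟩
  + catalan (suc e) * (K * K) ∎
  where
  d = suc e ℕ.+ suc e

  Δf*Δf∘suc-const : Δ^Const d (+ (d C suc e) * K * K) (λ m → Δ f m * Δ f (suc m))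
  Δf*Δf∘suc-const =
    Δ^Const-* (suc e) (suc e) (Δ f) (Δ f ∘ suc) f-const (Δ^Const-∘suc (suc e) (Δ f) f-const)

  f∘suc*Δ²f-const : Δ^Const d (+ (d C suc (suc e)) * K * K) (λ m → f (suc m) * Δ (Δ f) m)
  f∘suc*Δ²f-const =
    subst (λ d′ → Δ^Const d′ (+ (d′ C suc (suc e)) * K * K) (λ m → f (suc m) * Δ (Δ f) m))
          (cong suc (sym (ℕₚ.+-suc e e)))
          (Δ^Const-* (suc (suc e)) e (f ∘ suc) (Δ (Δ f)) (Δ^Const-∘suc (suc (suc e)) f f-const) f-const)

  factor : ∀ x y K → x * K * K - y * K * K ≡ (x - y) * (K * K)
  factor = solve-∀

IsPositivePolynomial : ℕ → (ℕ → ℤ) → Set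
IsPositivePolynomial d f = ∃[ c ] Δ^Const d +[1+ c ] f

L-isPositivePolynomial : ∀ m f → IsPositivePolynomial (suc m) f → IsPositivePolynomial (m ℕ.+ m) (L f)
L-isPositivePolynomial m f (c , f-const) with catalan m | catalan>0 m | L-Δ^Const m f f-const
... | suc t | _ | Lf-const = _ , Lf-const

L^-isPositivePolynomial : ∀ j e f → IsPositivePolynomial (2 ℕ.+ e) f →
                          ∃[ e′ ] IsPositivePolynomial (2 ℕ.+ e′) (L^ j f)
L^-isPositivePolynomial zero    e f f-pos = e , f-pos
L^-isPositivePolynomial (suc j) e f f-pos with L^-isPositivePolynomial j e f f-pos
... | e′ , L^jf-pos =
  e′ ℕ.+ e′ , subst (λ d → IsPositivePolynomial (suc d) (L^ (suc j) f))
                    (ℕₚ.+-suc e′ e′) (L-isPositivePolynomial (suc e′) (L^ j f) L^jf-pos)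

EventuallyPositive : (ℕ → ℤ) → Set
EventuallyPositive f = ∃[ N ] (∀ i → N ≤ i → 0ℤ < f i)

0<i+[1+∣i∣] : ∀ i → 0ℤ < i + + suc ∣ i ∣
0<i+[1+∣i∣] (+ n)    = +<+ (ℕₚ.≤-trans (s≤s z≤n) (ℕₚ.m≤n+m (suc n) n))
0<i+[1+∣i∣] -[1+ n ] = subst (0ℤ <_) (identity (+ n)) (+<+ (s≤s z≤n))
  where
  identity : ∀ x → + 1 ≡ - (+ 1 + x) + (+ 1 + (+ 1 + x))
  identity = solve-∀

eventuallyPositive-Δ⇒ : ∀ {f} → EventuallyPositive (Δ f) → EventuallyPositive f
eventuallyPositive-Δ⇒ {f} (N , Δf>0) = suc ∣ f N ∣ ℕ.+ N , f>0
  where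
  increasing : ∀ i → N ≤ i → f i < f (suc i)
  increasing i N≤i = subst₂ _<_ (ℤₚ.+-identityʳ (f i)) (cancel (f i) (f (suc i)))
                            (ℤₚ.+-monoʳ-< (f i) (Δf>0 i N≤i))
    where
    cancel : ∀ a b → a + (b - a) ≡ b
    cancel = solve-∀

  grows : ∀ m → f N + + m ℤ.≤ f (m ℕ.+ N)
  grows zero    = ℤₚ.≤-reflexive (ℤₚ.+-identityʳ (f N))
  grows (suc m) = ℤₚ.≤-trans (ℤₚ.≤-reflexive (shift (f N) (+ m)))
    (ℤₚ.≤-trans (ℤₚ.+-monoʳ-≤ (+ 1) (grows m))
                (ℤₚ.i<j⇒suc[i]≤j (increasing (m ℕ.+ N) (ℕₚ.m≤n+m N m))))
    where
    shift : ∀ a b → a + (+ 1 + b) ≡ + 1 + (a + b)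
    shift = solve-∀

  f>0 : ∀ i → suc ∣ f N ∣ ℕ.+ N ≤ i → 0ℤ < f i
  f>0 i bound≤i = ℤₚ.<-≤-trans (0<i+[1+∣i∣] (f N)) (ℤₚ.≤-trans
    (ℤₚ.+-monoʳ-≤ (f N) (ℤ.+≤+ (ℕₚ.m+n≤o⇒m≤o∸n (suc ∣ f N ∣) bound≤i)))
    (subst (λ j → f N + + (i ∸ N) ℤ.≤ f j)
           (ℕₚ.m∸n+n≡m (ℕₚ.m+n≤o⇒n≤o (suc ∣ f N ∣) bound≤i))
           (grows (i ∸ N))))

isPositivePolynomial⇒eventuallyPositive : ∀ d {f} → IsPositivePolynomial d f → EventuallyPositive f
isPositivePolynomial⇒eventuallyPositive zero    (c , f-const) =
  0 , λ i _ → subst (0ℤ <_) (sym (f-const i)) (+<+ (s≤s z≤n))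
isPositivePolynomial⇒eventuallyPositive (suc d) f-pos =
  eventuallyPositive-Δ⇒ (isPositivePolynomial⇒eventuallyPositive d f-pos)

eventuallyPositive⇒asympLogConcave : ∀ r {ω} → (∀ j → 1 ≤ j → j ≤ r → EventuallyPositive (L^ j ω)) →
                                     AsympLogConcave r ω
eventuallyPositive⇒asympLogConcave zero    _  = 0 , λ { zero () ; (suc j) _ () }
eventuallyPositive⇒asympLogConcave (suc r) ev
  with eventuallyPositive⇒asympLogConcave r (λ j 1≤j j≤r → ev j 1≤j (ℕₚ.m≤n⇒m≤1+n j≤r))
     | ev (suc r) (s≤s z≤n) ℕₚ.≤-refl
... | N₁ , below | N₂ , top = N₁ ⊔ N₂ , positive
  where
  positive : ∀ j → 1 ≤ j → j ≤ suc r → ∀ i → N₁ ⊔ N₂ ≤ i → 0ℤ < L^ j _ i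
  positive j 1≤j j≤1+r i N≤i with ℕₚ.m≤n⇒m<n∨m≡n j≤1+r
  ... | inj₁ (s≤s j≤r) = below j 1≤j j≤r i (ℕₚ.≤-trans (ℕₚ.m≤m⊔n N₁ N₂) N≤i)
  ... | inj₂ refl      = top i (ℕₚ.≤-trans (ℕₚ.m≤n⊔m N₁ N₂) N≤i)

L^≡0⇒¬asympLogConcave : ∀ r {ω} → 1 ≤ r → (∀ i → L^ r ω i ≡ 0ℤ) → ¬ AsympLogConcave r ω
L^≡0⇒¬asympLogConcave r 1≤r L^rω≡0 (N , positive) =
  ℤₚ.<-irrefl (sym (L^rω≡0 N)) (positive r 1≤r ℕₚ.≤-refl N ℕₚ.≤-refl)

Δ-seqP : ∀ k n → Δ (seqP (suc k)) n ≡ seqP k (suc n)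
Δ-seqP k n = begin
  + p ones (suc k) (suc n) - + p ones (suc k) n
    ≡⟨ cong (λ x → + x - + p ones (suc k) n) (p-ones-suc k n) ⟩
  + (p ones k (suc n) ℕ.+ p ones (suc k) n) - + p ones (suc k) n
    ≡⟨ +m-+n≡+[m∸n] (ℕₚ.m≤n+m (p ones (suc k) n) (p ones k (suc n))) ⟩
  + (p ones k (suc n) ℕ.+ p ones (suc k) n ∸ p ones (suc k) n)
    ≡⟨ cong +_ (ℕₚ.m+n∸n≡m (p ones k (suc n)) (p ones (suc k) n)) ⟩
  + p ones k (suc n) ∎

seqP-Δ^Const : ∀ k → Δ^Const k (+ 1) (seqP (suc k))
seqP-Δ^Const zero    n = cong +_ (p-ones-1 n)
seqP-Δ^Const (suc k) n = begin
  Δ^ k (Δ (seqP (2 ℕ.+ k))) n     ≡⟨ Δ^-cong k (Δ-seqP (suc k)) n ⟩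
  Δ^ k (seqP (suc k) ∘ suc) n     ≡⟨ Δ^Const-∘suc k (seqP (suc k)) (seqP-Δ^Const k) n ⟩
  + 1                             ∎

seqP1-¬LC1 : ¬ AsympLogConcave 1 (seqP 1)
seqP1-¬LC1 = L^≡0⇒¬asympLogConcave 1 ℕₚ.≤-refl (L-Δ^Const-0 (seqP 1) (seqP-Δ^Const 0))

L-seqP2-isPositivePolynomial : IsPositivePolynomial 0 (L (seqP 2))
L-seqP2-isPositivePolynomial = L-isPositivePolynomial 0 (seqP 2) (0 , seqP-Δ^Const 1)

seqP2-LC1 : AsympLogConcave 1 (seqP 2)
seqP2-LC1 = eventuallyPositive⇒asympLogConcave 1 λ
  { zero () ; (suc zero) _ _ → isPositivePolynomial⇒eventuallyPositive 0 L-seqP2-isPositivePolynomial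
  ; (suc (suc j)) _ (s≤s ()) }

seqP2-¬LC2 : ¬ AsympLogConcave 2 (seqP 2)
seqP2-¬LC2 =
  L^≡0⇒¬asympLogConcave 2 (s≤s z≤n) (L-Δ^Const-0 (L (seqP 2)) (proj₂ L-seqP2-isPositivePolynomial))

seqP3+-LC : ∀ e r → AsympLogConcave r (seqP (3 ℕ.+ e))
seqP3+-LC e r = eventuallyPositive⇒asympLogConcave r λ j _ _ →
  let e′ , L^j-pos = L^-isPositivePolynomial j e (seqP (3 ℕ.+ e)) (0 , seqP-Δ^Const (2 ℕ.+ e))
  in isPositivePolynomial⇒eventuallyPositive (2 ℕ.+ e′) L^j-pos

corollary4p12 : (k : ℕ) → 1 ≤ k →
    ((¬ AsympLogConcave 1 (seqP k)) ⇔ (k ≡ 1))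
    × ((AsympLogConcave 1 (seqP k) × ¬ AsympLogConcave 2 (seqP k)) ⇔ (k ≡ 2))
    × ((∀ r → 1 ≤ r → AsympLogConcave r (seqP k)) ⇔ (3 ≤ k))
corollary4p12 1 _ =
  mk⇔ (λ _ → refl) (λ _ → seqP1-¬LC1) ,
  mk⇔ (λ (lc1 , _) → ⊥-elim (seqP1-¬LC1 lc1)) (λ ()) ,
  mk⇔ (λ lc → ⊥-elim (seqP1-¬LC1 (lc 1 ℕₚ.≤-refl))) (λ { (s≤s ()) })
corollary4p12 2 _ =
  mk⇔ (λ ¬lc1 → ⊥-elim (¬lc1 seqP2-LC1)) (λ ()) ,
  mk⇔ (λ _ → refl) (λ _ → seqP2-LC1 , seqP2-¬LC2) ,
  mk⇔ (λ lc → ⊥-elim (seqP2-¬LC2 (lc 2 (s≤s z≤n)))) (λ { (s≤s (s≤s ())) })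
corollary4p12 (suc (suc (suc e))) _ =
  mk⇔ (λ ¬lc1 → ⊥-elim (¬lc1 (seqP3+-LC e 1))) (λ ()) ,
  mk⇔ (λ (_ , ¬lc2) → ⊥-elim (¬lc2 (seqP3+-LC e 2))) (λ ()) ,
  mk⇔ (λ _ → s≤s (s≤s (s≤s z≤n))) (λ _ r _ → seqP3+-LC e r)
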